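{- Fix $\alpha,\beta>0$ and images $\mathcal{I},\mathcal{J}\colon[n]\times[n]\to\Sigma$. Suppose that $d_H(\mathcal{J},\mathcal{J}')\le\alpha$ for every image $\mathcal{J}'\colon[n]\times[n]\to\Sigma$ with $d_e(\mathcal{J},\mathcal{J}')\le\beta$. Then $d_H(\mathcal{I},\mathcal{I}')\le\alpha+2d_H(\mathcal{I},\mathcal{J})$ for every image $\mathcal{I}'\colon[n]\times[n]\to\Sigma$ with $d_e(\mathcal{I},\mathcal{I}')\le\beta$.
   Context: $\Sigma$ is a finite alphabet; $d_H(\mathcal{I},\mathcal{J})$ is the fraction of pixels $(i,j)$ with $\mathcal{I}(i,j)\ne\mathcal{J}(i,j)$. For the earthmover distance, an image is identified with the ordered graph on $[2n]$ (vertices $1,\dots,n$ the rows, $n+1,\dots,2n$ the columns) coloring $\{x,n+y\}$ by $\mathcal{I}(x,y)$ and every pair of two rows or two columns by a special symbol; a basic move swaps two consecutive vertices of $[2n]$, $D_e$ is the minimum number of basic moves transforming one graph into the other ($+\infty$ if impossible), and $d_e=D_e/\binom{2n}{2}$.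
   Formalization: The parameters α and β are rational. -}

module Defs where

open import Data.Nat using (ℕ; zero; suc; _+_; _*_; NonZero)
open import Data.Nat.Properties using (m*n≢0; +-suc)
open import Data.Nat.Combinatorics using (_C_; nC1≡n; nCk+nC[k+1]≡[n+1]C[k+1])
open import Data.Fin using (Fin; toℕ; splitAt; _≟_)
open import Data.Sum using (inj₁; inj₂)
open import Data.Maybe using (Maybe; just; nothing)
open import Data.Integer using (+_)
open import Data.Rational using (ℚ; _/_; _≤_)
open import Data.Product using (∃; _×_)
open import Relation.Nullary using (yes; no)
open import Relation.Binary.PropositionalEquality using (_≡_; subst; trans; sym; cong)

Image : ℕ → ℕ → Set
Image k n = Fin n → Fin n → Fin k

sumFin : ∀ {n} → (Fin n → ℕ) → ℕ
sumFin {zero}  f = 0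
sumFin {suc n} f = f Fin.zero + sumFin (λ i → f (Fin.suc i))
  where import Data.Fin as Fin

mismatches : ∀ {k n} → Image k n → Image k n → ℕ
mismatches I J = sumFin (λ i → sumFin (λ j → diff (I i j ≟ J i j)))
  where
  diff : ∀ {a b : Fin _} → Relation.Nullary.Dec (a ≡ b) → ℕ
  diff (yes _) = 0
  diff (no _)  = 1
    where import Relation.Nullary

dH : ∀ {k n} .{{_ : NonZero n}} → Image k n → Image k n → ℚ
dH {n = n} I J = (+ mismatches I J) / (n * n)
  where instance _ = m*n≢0 n n

-- Complete edge-coloured ordered graph on [m]: colour of pair {u,v};
-- nothing is the special symbol.
Graph : ℕ → ℕ → Set
Graph k m = Fin m → Fin m → Maybe (Fin k)

-- Graph of an image: vertices 1..n rows, n+1..2n columns.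
graphOf : ∀ {k n} → Image k n → Graph k (n + n)
graphOf {n = n} I u v with splitAt n u | splitAt n v
... | inj₁ x | inj₂ y = just (I x y)
... | inj₂ y | inj₁ x = just (I x y)
... | inj₁ _ | inj₁ _ = nothing
... | inj₂ _ | inj₂ _ = nothing

swap : ∀ {m} → Fin m → Fin m → Fin m → Fin m
swap i j x with x ≟ i
... | yes _ = j
... | no _ with x ≟ j
...   | yes _ = i
...   | no _  = x

BasicMove : ∀ {k m} → Graph k m → Graph k m → Set
BasicMove {m = m} G H =
  ∃ λ (i : Fin m) → ∃ λ (j : Fin m) → (toℕ j ≡ suc (toℕ i)) ×
    (∀ u v → H u v ≡ G (swap i j u) (swap i j v))

data Moves {k m : ℕ} : ℕ → Graph k m → Graph k m → Set where
  done : ∀ {G H} → (∀ u v → G u v ≡ H u v) → Moves zero G H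
  step : ∀ {s G G′ H} → BasicMove G G′ → Moves s G′ H → Moves (suc s) G H

pairs≢0 : ∀ n .{{_ : NonZero n}} → NonZero ((n + n) C 2)
pairs≢0 (suc n) = subst NonZero eq _
  where
  N = n + suc n
  eq : suc (n + n) + N C 2 ≡ (suc n + suc n) C 2
  eq = trans (cong (_+ N C 2) (sym (trans (nC1≡n N) (+-suc n n))))
             (nCk+nC[k+1]≡[n+1]C[k+1] N 1)

-- Earthmover distance bound: d_e(G,H) ≤ β, i.e. D_e(G,H) / binom(2n,2) ≤ β,
-- where D_e is the minimum number of basic moves (+∞ if none); equivalently
-- some transformation by s basic moves exists with s / binom(2n,2) ≤ β.
deLe : ∀ {k n} .{{_ : NonZero n}} → Image k n → Image k n → ℚ → Set
deLe {n = n} I J β =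
  ∃ λ s → Moves s (graphOf I) (graphOf J) × ((+ s) / ((n + n) C 2)) ≤ β
  where instance _ = pairs≢0 n

-- A sequence of basic moves only relabels the vertices: it carries the graph of I to its relabelling by
-- some permutation σ of [2n]. Since σ maps the graph of I onto the graph of an image, it respects the
-- row/column pattern, so σ also carries the graph of J to the graph of an image J′, and the same moves
-- take J to J′; hence d_H(J, J′) ≤ α. Counting disagreeing entries of graphs (twice the count for the
-- images, and invariant under relabelling both graphs by σ), the triangle inequality through the graphs
-- of J and J′ gives 2 #(I, I′) ≤ 2 #(I, J) + 2 #(J, J′) + 2 #(J, I).
module Submission where

open import Defs
open import Data.Bool using (if_then_else_)
open import Data.Fin as Fin using (Fin; zero; suc; _↑ˡ_; _↑ʳ_; splitAt)
open import Data.Fin.Permutation as Perm using (Permutation′; _⟨$⟩ʳ_; _∘ₚ_)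
open import Data.Fin.Properties using (splitAt-↑ˡ; splitAt-↑ʳ; splitAt⁻¹-↑ˡ; splitAt⁻¹-↑ʳ)
open import Data.Integer as ℤ using (+_; +≤+)
import Data.Integer.Properties as ℤ
import Data.Integer.Tactic.RingSolver as ℤ-Solver
open import Data.Maybe using (Maybe; just; nothing; fromMaybe)
open import Data.Maybe.Properties using (≡-dec)
open import Data.Nat as ℕ using (ℕ; zero; suc; NonZero; z≤n; s≤s)
open import Data.Nat.Properties as ℕ using (+-0-commutativeMonoid)
import Data.Nat.Tactic.RingSolver as ℕ-Solver
open import Data.Product using (∃; _,_; proj₁; proj₂)
open import Data.Sum using (inj₁; inj₂)
open import Data.Rational using (ℚ; mkℚ; 1ℚ; 0ℚ; ↥_; ↧_; _/_; _≤_; _<_; _+_; _*_; toℚᵘ)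
open import Data.Rational.Properties as ℚ
  using (↥-/; ↧-/; toℚᵘ-injective; toℚᵘ-cancel-≤; toℚᵘ-homo-+; *-distribʳ-+; *-identityˡ)
import Data.Rational.Unnormalised as ℚᵘ
open import Data.Rational.Unnormalised using (*≡*; *≤*) renaming (_≃_ to _≃ᵘ_)
import Data.Rational.Unnormalised.Properties as ℚᵘ
open import Data.Vec.Functional using (Vector)
open import Function using (_∘_; flip)
open import Relation.Binary.Definitions using (DecidableEquality)
open import Relation.Binary.PropositionalEquality
open import Relation.Nullary using (yes; no; does; contradiction)

open import Algebra.Properties.CommutativeMonoid.Sum +-0-commutativeMonoid
  using (sum; ∑-distrib-+; ∑-comm; ∑-permute; sum-cong-≗; sum-replicate-zero)

sumFin≡sum : ∀ {n} {f g : Vector ℕ n} → (∀ i → f i ≡ g i) → sumFin f ≡ sum g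
sumFin≡sum {zero}  f≗g = refl
sumFin≡sum {suc n} f≗g = cong₂ ℕ._+_ (f≗g zero) (sumFin≡sum (f≗g ∘ suc))

sum-↑ : ∀ m {n} (f : Vector ℕ (m ℕ.+ n)) → sum f ≡ sum (f ∘ (_↑ˡ n)) ℕ.+ sum (f ∘ (m ↑ʳ_))
sum-↑ zero    f = refl
sum-↑ (suc m) f = trans (cong (f zero ℕ.+_) (sum-↑ m (f ∘ suc))) (sym (ℕ.+-assoc (f zero) _ _))

sum-zero : ∀ {n} {f : Vector ℕ n} → (∀ i → f i ≡ 0) → sum f ≡ 0
sum-zero {n} f≗0 = trans (sum-cong-≗ f≗0) (sum-replicate-zero n)

sum-mono-≤ : ∀ {n} {f g : Vector ℕ n} → (∀ i → f i ℕ.≤ g i) → sum f ℕ.≤ sum g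
sum-mono-≤ {zero}  f≤g = z≤n
sum-mono-≤ {suc n} f≤g = ℕ.+-mono-≤ (f≤g zero) (sum-mono-≤ (f≤g ∘ suc))

module Hamming {a} {A : Set a} (_≟_ : DecidableEquality A) where

  mismatch : A → A → ℕ
  mismatch x y = if does (x ≟ y) then 0 else 1

  mismatch-self : ∀ x → mismatch x x ≡ 0
  mismatch-self x with x ≟ x
  ... | yes _   = refl
  ... | no x≢x = contradiction refl x≢x

  mismatch-sym : ∀ x y → mismatch x y ≡ mismatch y x
  mismatch-sym x y with x ≟ y | y ≟ x
  ... | yes _   | yes _   = refl
  ... | no _    | no _    = refl
  ... | yes x≡y | no y≢x = contradiction (sym x≡y) y≢x
  ... | no x≢y  | yes y≡x = contradiction (sym y≡x) x≢y

  mismatch-triangle : ∀ x y z → mismatch x z ℕ.≤ mismatch x y ℕ.+ mismatch y z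
  mismatch-triangle x y z with x ≟ z | x ≟ y | y ≟ z
  ... | yes _   | _        | _        = z≤n
  ... | no x≢z  | yes refl | yes refl = contradiction refl x≢z
  ... | no _    | yes _    | no _     = s≤s z≤n
  ... | no _    | no _     | _        = s≤s z≤n

  Matrix : ℕ → ℕ → Set a
  Matrix m n = Fin m → Fin n → A

  distance : ∀ {m n} → Matrix m n → Matrix m n → ℕ
  distance M N = sum λ i → sum λ j → mismatch (M i j) (N i j)

  module _ {m n : ℕ} where

    distance-cong : {M M′ N N′ : Matrix m n} → (∀ i j → M i j ≡ M′ i j) → (∀ i j → N i j ≡ N′ i j) →
                    distance M N ≡ distance M′ N′
    distance-cong M≗M′ N≗N′ = sum-cong-≗ λ i → sum-cong-≗ λ j → cong₂ mismatch (M≗M′ i j) (N≗N′ i j)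

    distance-self : (M : Matrix m n) → distance M M ≡ 0
    distance-self M = sum-zero λ i → sum-zero λ j → mismatch-self (M i j)

    distance-sym : (M N : Matrix m n) → distance M N ≡ distance N M
    distance-sym M N = sum-cong-≗ λ i → sum-cong-≗ λ j → mismatch-sym (M i j) (N i j)

    distance-triangle : (M N P : Matrix m n) → distance M P ℕ.≤ distance M N ℕ.+ distance N P
    distance-triangle M N P = ℕ.≤-trans (sum-mono-≤ row-triangle) (ℕ.≤-reflexive (∑-distrib-+ (row M N) (row N P)))
      where
      row : Matrix m n → Matrix m n → Fin m → ℕ
      row M N i = sum λ j → mismatch (M i j) (N i j)

      row-triangle : ∀ i → row M P i ℕ.≤ row M N i ℕ.+ row N P i
      row-triangle i = ℕ.≤-trans (sum-mono-≤ λ j → mismatch-triangle (M i j) (N i j) (P i j))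
        (ℕ.≤-reflexive (∑-distrib-+ (λ j → mismatch (M i j) (N i j)) (λ j → mismatch (N i j) (P i j))))

    distance-permute : (M N : Matrix m n) (π : Permutation′ m) (ρ : Permutation′ n) →
      distance (λ i j → M (π ⟨$⟩ʳ i) (ρ ⟨$⟩ʳ j)) (λ i j → N (π ⟨$⟩ʳ i) (ρ ⟨$⟩ʳ j)) ≡ distance M N
    distance-permute M N π ρ = sym (trans (∑-permute (λ i → sum λ j → mismatch (M i j) (N i j)) π)
      (sum-cong-≗ λ i → ∑-permute (λ j → mismatch (M (π ⟨$⟩ʳ i) j) (N (π ⟨$⟩ʳ i) j)) ρ))

    distance-transpose : (M N : Matrix m n) → distance (flip M) (flip N) ≡ distance M N
    distance-transpose M N = sym (∑-comm (λ i j → mismatch (M i j) (N i j)))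

  distance-blocks : ∀ {m m′ n n′} (M N : Matrix (m ℕ.+ m′) (n ℕ.+ n′)) → distance M N ≡
    (distance (λ i j → M (i ↑ˡ m′) (j ↑ˡ n′)) (λ i j → N (i ↑ˡ m′) (j ↑ˡ n′)) ℕ.+
     distance (λ i j → M (i ↑ˡ m′) (n ↑ʳ j)) (λ i j → N (i ↑ˡ m′) (n ↑ʳ j))) ℕ.+
    (distance (λ i j → M (m ↑ʳ i) (j ↑ˡ n′)) (λ i j → N (m ↑ʳ i) (j ↑ˡ n′)) ℕ.+
     distance (λ i j → M (m ↑ʳ i) (n ↑ʳ j)) (λ i j → N (m ↑ʳ i) (n ↑ʳ j)))
  distance-blocks {m} {m′} {n} {n′} M N =
    trans (sum-↑ m (λ i → sum (entry i))) (cong₂ ℕ._+_ (split-columns (entry ∘ (_↑ˡ m′))) (split-columns (entry ∘ (m ↑ʳ_))))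
    where
    entry : Fin (m ℕ.+ m′) → Fin (n ℕ.+ n′) → ℕ
    entry i j = mismatch (M i j) (N i j)

    split-columns : ∀ {r} (f : Fin r → Fin (n ℕ.+ n′) → ℕ) →
      sum (λ i → sum (f i)) ≡ sum (λ i → sum (λ j → f i (j ↑ˡ n′))) ℕ.+ sum (λ i → sum (λ j → f i (n ↑ʳ j)))
    split-columns f = trans (sum-cong-≗ λ i → sum-↑ n (f i))
      (∑-distrib-+ (λ i → sum (λ j → f i (j ↑ˡ n′))) (λ i → sum (λ j → f i (n ↑ʳ j))))

module Pixels {k : ℕ} = Hamming (Fin._≟_ {k})
module Edges {k : ℕ} = Hamming (≡-dec (Fin._≟_ {k}))

-- The per-pixel indicator of mismatches is local to Defs; the 1 × 1 case exposes it (plus two zeros).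
mismatches-pixel : ∀ {k} (a b : Fin k) → mismatches {n = 1} (λ _ _ → a) (λ _ _ → b) ≡ Pixels.mismatch a b
mismatches-pixel a b with a Fin.≟ b
... | yes _ = refl
... | no _  = refl

mismatches≡distance : ∀ {k n} (I J : Image k n) → mismatches I J ≡ Pixels.distance I J
mismatches≡distance I J = sumFin≡sum λ i → sumFin≡sum λ j →
  trans (sym (ℕ.+-identityʳ _)) (trans (sym (ℕ.+-identityʳ _)) (mismatches-pixel (I i j) (J i j)))

data ↑-View {m n : ℕ} : Fin (m ℕ.+ n) → Set where
  ↑ˡ-view : ∀ x → ↑-View (x ↑ˡ n)
  ↑ʳ-view : ∀ y → ↑-View (m ↑ʳ y)

↑-view : ∀ m {n} (u : Fin (m ℕ.+ n)) → ↑-View u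
↑-view m u with splitAt m u in eq
... | inj₁ x = subst ↑-View (splitAt⁻¹-↑ˡ eq) (↑ˡ-view x)
... | inj₂ y = subst ↑-View (splitAt⁻¹-↑ʳ eq) (↑ʳ-view y)

module _ {k n : ℕ} (I : Image k n) where

  graphOf-↑ˡ-↑ʳ : ∀ x y → graphOf I (x ↑ˡ n) (n ↑ʳ y) ≡ just (I x y)
  graphOf-↑ˡ-↑ʳ x y rewrite splitAt-↑ˡ n x n | splitAt-↑ʳ n n y = refl

  graphOf-↑ʳ-↑ˡ : ∀ y x → graphOf I (n ↑ʳ y) (x ↑ˡ n) ≡ just (I x y)
  graphOf-↑ʳ-↑ˡ y x rewrite splitAt-↑ˡ n x n | splitAt-↑ʳ n n y = refl

  graphOf-↑ˡ-↑ˡ : ∀ x y → graphOf I (x ↑ˡ n) (y ↑ˡ n) ≡ nothing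
  graphOf-↑ˡ-↑ˡ x y rewrite splitAt-↑ˡ n x n | splitAt-↑ˡ n y n = refl

  graphOf-↑ʳ-↑ʳ : ∀ x y → graphOf I (n ↑ʳ x) (n ↑ʳ y) ≡ nothing
  graphOf-↑ʳ-↑ʳ x y rewrite splitAt-↑ʳ n n x | splitAt-↑ʳ n n y = refl

  graphOf-sym : ∀ u v → graphOf I u v ≡ graphOf I v u
  graphOf-sym u v with splitAt n u | splitAt n v
  ... | inj₁ _ | inj₁ _ = refl
  ... | inj₁ _ | inj₂ _ = refl
  ... | inj₂ _ | inj₁ _ = refl
  ... | inj₂ _ | inj₂ _ = refl

module _ {k n : ℕ} (I J : Image k n) where

  graphOf-nothing : ∀ {u v} → graphOf I u v ≡ nothing → graphOf J u v ≡ nothing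
  graphOf-nothing {u} {v} eq with splitAt n u | splitAt n v
  ... | inj₁ _ | inj₁ _ = refl
  ... | inj₂ _ | inj₂ _ = refl

  graphOf-just : ∀ {u v a} → graphOf I u v ≡ just a → ∃ λ b → graphOf J u v ≡ just b
  graphOf-just {u} {v} eq with splitAt n u | splitAt n v
  ... | inj₁ x | inj₂ y = J x y , refl
  ... | inj₂ y | inj₁ x = J x y , refl

distance-graphOf : ∀ {k n} (I J : Image k n) → Edges.distance (graphOf I) (graphOf J) ≡ 2 ℕ.* Pixels.distance I J
distance-graphOf {k} {n} I J = trans (Edges.distance-blocks {m = n} {m′ = n} {n = n} {n′ = n} (graphOf I) (graphOf J))
  (cong₂ ℕ._+_ (cong₂ ℕ._+_ (same-side graphOf-↑ˡ-↑ˡ) (Edges.distance-cong (graphOf-↑ˡ-↑ʳ I) (graphOf-↑ˡ-↑ʳ J)))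
               (cong₂ ℕ._+_ (trans (Edges.distance-cong (graphOf-↑ʳ-↑ˡ I) (graphOf-↑ʳ-↑ˡ J)) (Pixels.distance-transpose I J))
                            (same-side graphOf-↑ʳ-↑ʳ)))
  where
  same-side : ∀ {M : Image k n → Fin n → Fin n → Maybe (Fin k)} → (∀ K x y → M K x y ≡ nothing) →
              Edges.distance (M I) (M J) ≡ 0
  same-side M≡nothing = trans (Edges.distance-cong (M≡nothing I) (M≡nothing J)) (Edges.distance-self {k} {n} {n} (λ _ _ → nothing))

_≐_ : ∀ {k m} → Graph k m → Graph k m → Set
G ≐ H = ∀ u v → G u v ≡ H u v

relabel : ∀ {k m} → Permutation′ m → Graph k m → Graph k m
relabel σ G u v = G (σ ⟨$⟩ʳ u) (σ ⟨$⟩ʳ v)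

swap≗transpose : ∀ {m} (i j x : Fin m) → swap i j x ≡ Perm.transpose i j ⟨$⟩ʳ x
swap≗transpose i j x with x Fin.≟ i
... | yes _ = refl
... | no _ with x Fin.≟ j
...   | yes _ = refl
...   | no _  = refl

module _ {k m : ℕ} where

  moves-permutation : ∀ {s} {G H : Graph k m} → Moves s G H → Permutation′ m
  moves-permutation (done _)                     = Perm.id
  moves-permutation (step (i , j , _ , _) moves) = moves-permutation moves ∘ₚ Perm.transpose i j

  relabel-swap : ∀ (G : Graph k m) i j σ →
                 relabel σ (λ u v → G (swap i j u) (swap i j v)) ≐ relabel (σ ∘ₚ Perm.transpose i j) G
  relabel-swap G i j σ u v = cong₂ G (swap≗transpose i j (σ ⟨$⟩ʳ u)) (swap≗transpose i j (σ ⟨$⟩ʳ v))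

  moves-relabel : ∀ {s} {G H : Graph k m} (moves : Moves s G H) → H ≐ relabel (moves-permutation moves) G
  moves-relabel (done G≐H) u v = sym (G≐H u v)
  moves-relabel {G = G} (step (i , j , _ , G′≐swapG) moves) u v =
    trans (moves-relabel moves u v) (trans (G′≐swapG _ _) (relabel-swap G i j (moves-permutation moves) u v))

  moves-replay : ∀ {s} {G H G′ H′ : Graph k m} (moves : Moves s G H) →
                 H′ ≐ relabel (moves-permutation moves) G′ → Moves s G′ H′
  moves-replay (done _) H′≐G′ = done λ u v → sym (H′≐G′ u v)
  moves-replay {G′ = G′} (step (i , j , j≡1+i , _) moves) H′≐σG′ =
    step (i , j , j≡1+i , λ u v → refl)
         (moves-replay moves λ u v → trans (H′≐σG′ u v) (sym (relabel-swap G′ i j (moves-permutation moves) u v)))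

just-fromMaybe : ∀ {a} {A : Set a} {d : A} {m : Maybe A} {x} → m ≡ just x → just (fromMaybe d m) ≡ m
just-fromMaybe refl = refl

relabel-graphOf : ∀ {k n} {I I′ : Image k n} (σ : Permutation′ (n ℕ.+ n)) →
  graphOf I′ ≐ relabel σ (graphOf I) → (J : Image k n) → ∃ λ J′ → graphOf J′ ≐ relabel σ (graphOf J)
relabel-graphOf {k} {n} {I} {I′} σ I′≐σI J = J′ , J′≐σJ
  where
  σJ : Graph k (n ℕ.+ n)
  σJ = relabel σ (graphOf J)

  -- The default I′ x y is never used: σJ is `just` on row–column pairs (σJ-↑ˡ-↑ʳ).
  J′ : Image k n
  J′ x y = fromMaybe (I′ x y) (σJ (x ↑ˡ n) (n ↑ʳ y))

  σJ-↑ˡ-↑ʳ : ∀ x y → just (J′ x y) ≡ σJ (x ↑ˡ n) (n ↑ʳ y)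
  σJ-↑ˡ-↑ʳ x y = just-fromMaybe (proj₂ (graphOf-just I J (trans (sym (I′≐σI _ _)) (graphOf-↑ˡ-↑ʳ I′ x y))))

  σJ-same-side : ∀ {u v} → graphOf I′ u v ≡ nothing → σJ u v ≡ nothing
  σJ-same-side {u} {v} eq = graphOf-nothing I J (trans (sym (I′≐σI u v)) eq)

  J′≐σJ : graphOf J′ ≐ σJ
  J′≐σJ u v with ↑-view n u | ↑-view n v
  ... | ↑ˡ-view x | ↑ʳ-view y = trans (graphOf-↑ˡ-↑ʳ J′ x y) (σJ-↑ˡ-↑ʳ x y)
  ... | ↑ʳ-view y | ↑ˡ-view x = trans (graphOf-↑ʳ-↑ˡ J′ y x)
                                  (trans (σJ-↑ˡ-↑ʳ x y) (graphOf-sym J (σ ⟨$⟩ʳ (x ↑ˡ n)) (σ ⟨$⟩ʳ (n ↑ʳ y))))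
  ... | ↑ˡ-view x | ↑ˡ-view y = trans (graphOf-↑ˡ-↑ˡ J′ x y) (sym (σJ-same-side (graphOf-↑ˡ-↑ˡ I′ x y)))
  ... | ↑ʳ-view x | ↑ʳ-view y = trans (graphOf-↑ʳ-↑ʳ J′ x y) (sym (σJ-same-side (graphOf-↑ʳ-↑ʳ I′ x y)))

mismatches-relabel : ∀ {k n} {I J I′ J′ : Image k n} (σ : Permutation′ (n ℕ.+ n)) →
  graphOf I′ ≐ relabel σ (graphOf I) → graphOf J′ ≐ relabel σ (graphOf J) →
  mismatches I I′ ℕ.≤ mismatches J J′ ℕ.+ 2 ℕ.* mismatches I J
mismatches-relabel {k} {n} {I} {J} {I′} {J′} σ I′≐σI J′≐σJ = begin
  mismatches I I′                    ≡⟨ mismatches≡distance I I′ ⟩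
  d I I′                             ≤⟨ ℕ.*-cancelˡ-≤ 2 doubled ⟩
  d J J′ ℕ.+ 2 ℕ.* d I J             ≡⟨ cong₂ (λ b c → b ℕ.+ 2 ℕ.* c) (mismatches≡distance J J′) (mismatches≡distance I J) ⟨
  mismatches J J′ ℕ.+ 2 ℕ.* mismatches I J ∎
  where
  open ℕ.≤-Reasoning
  d : Image k n → Image k n → ℕ
  d = Pixels.distance

  D : Graph k (n ℕ.+ n) → Graph k (n ℕ.+ n) → ℕ
  D = Edges.distance

  gI gJ gI′ gJ′ : Graph k (n ℕ.+ n)
  gI = graphOf I; gJ = graphOf J; gI′ = graphOf I′; gJ′ = graphOf J′

  relabelled : D gJ′ gI′ ≡ D gI gJ
  relabelled = trans (Edges.distance-cong J′≐σJ I′≐σI)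
                     (trans (Edges.distance-permute gJ gI σ σ) (Edges.distance-sym gJ gI))

  regroup : ∀ b c → 2 ℕ.* c ℕ.+ (2 ℕ.* b ℕ.+ 2 ℕ.* c) ≡ 2 ℕ.* (b ℕ.+ 2 ℕ.* c)
  regroup = ℕ-Solver.solve-∀

  doubled : 2 ℕ.* d I I′ ℕ.≤ 2 ℕ.* (d J J′ ℕ.+ 2 ℕ.* d I J)
  doubled = begin
    2 ℕ.* d I I′                        ≡⟨ distance-graphOf I I′ ⟨
    D gI gI′                            ≤⟨ Edges.distance-triangle gI gJ gI′ ⟩
    D gI gJ ℕ.+ D gJ gI′                ≤⟨ ℕ.+-monoʳ-≤ (D gI gJ) (Edges.distance-triangle gJ gJ′ gI′) ⟩
    D gI gJ ℕ.+ (D gJ gJ′ ℕ.+ D gJ′ gI′) ≡⟨ cong (λ t → D gI gJ ℕ.+ (D gJ gJ′ ℕ.+ t)) relabelled ⟩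
    D gI gJ ℕ.+ (D gJ gJ′ ℕ.+ D gI gJ)   ≡⟨ cong₂ (λ c b → c ℕ.+ (b ℕ.+ c)) (distance-graphOf I J) (distance-graphOf J J′) ⟩
    2 ℕ.* d I J ℕ.+ (2 ℕ.* d J J′ ℕ.+ 2 ℕ.* d I J) ≡⟨ regroup (d J J′) (d I J) ⟩
    2 ℕ.* (d J J′ ℕ.+ 2 ℕ.* d I J)      ∎

toℚᵘ-/ : ∀ i n .{{_ : NonZero n}} → toℚᵘ (i / n) ≃ᵘ i ℚᵘ./ n
toℚᵘ-/ i n@(suc _) = scaled (i / n) (↥-/ i n) (↧-/ i n)
  where
  rearrange : ∀ x y z → x ℤ.* (y ℤ.* z) ≡ (x ℤ.* z) ℤ.* y
  rearrange = ℤ-Solver.solve-∀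

  scaled : ∀ q {g} → ↥ q ℤ.* g ≡ i → ↧ q ℤ.* g ≡ + n → toℚᵘ q ≃ᵘ i ℚᵘ./ n
  scaled q@(mkℚ _ _ _) {g} ↥q*g≡i ↧q*g≡n = *≡* (begin
      ↥ q ℤ.* + n              ≡⟨ cong (↥ q ℤ.*_) ↧q*g≡n ⟨
      ↥ q ℤ.* (↧ q ℤ.* g)      ≡⟨ rearrange (↥ q) (↧ q) g ⟩
      (↥ q ℤ.* g) ℤ.* ↧ q      ≡⟨ cong (ℤ._* ↧ q) ↥q*g≡i ⟩
      i ℤ.* ↧ q                ∎)
    where open ≡-Reasoning

/-monoˡ-≤ : ∀ {i j} n .{{_ : NonZero n}} → i ℤ.≤ j → i / n ≤ j / n
/-monoˡ-≤ {i} {j} n@(suc _) i≤j = toℚᵘ-cancel-≤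
  (ℚᵘ.≤-respˡ-≃ (ℚᵘ.≃-sym (toℚᵘ-/ i n)) (ℚᵘ.≤-respʳ-≃ (ℚᵘ.≃-sym (toℚᵘ-/ j n))
    (*≤* (ℤ.*-monoʳ-≤-nonNeg (+ n) i≤j))))

/-distribʳ-+ : ∀ i j n .{{_ : NonZero n}} → (i ℤ.+ j) / n ≡ i / n + j / n
/-distribʳ-+ i j n@(suc _) = toℚᵘ-injective (ℚᵘ.≃-trans (toℚᵘ-/ (i ℤ.+ j) n) (ℚᵘ.≃-sym
  (ℚᵘ.≃-trans (toℚᵘ-homo-+ (i / n) (j / n))
    (ℚᵘ.≃-trans (ℚᵘ.+-cong (toℚᵘ-/ i n) (toℚᵘ-/ j n)) (*≡* (distrib i j (+ n)))))))
  where
  distrib : ∀ x y z → (x ℤ.* z ℤ.+ y ℤ.* z) ℤ.* z ≡ (x ℤ.+ y) ℤ.* (z ℤ.* z)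
  distrib = ℤ-Solver.solve-∀

two*p≡p+p : ∀ p → (+ 2 / 1) * p ≡ p + p
two*p≡p+p p = begin
  (1ℚ + 1ℚ) * p    ≡⟨ *-distribʳ-+ p 1ℚ 1ℚ ⟩
  1ℚ * p + 1ℚ * p  ≡⟨ cong₂ _+_ (*-identityˡ p) (*-identityˡ p) ⟩
  p + p            ∎
  where open ≡-Reasoning

/-double : ∀ m n .{{_ : NonZero n}} → (+ (2 ℕ.* m)) / n ≡ (+ 2 / 1) * ((+ m) / n)
/-double m n = begin
  (+ (2 ℕ.* m)) / n       ≡⟨ cong (λ t → (+ (m ℕ.+ t)) / n) (ℕ.+-identityʳ m) ⟩
  (+ m ℤ.+ + m) / n       ≡⟨ /-distribʳ-+ (+ m) (+ m) n ⟩
  (+ m) / n + (+ m) / n   ≡⟨ two*p≡p+p ((+ m) / n) ⟨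
  (+ 2 / 1) * ((+ m) / n) ∎
  where open ≡-Reasoning

lemma19 : (k n : ℕ) .{{_ : NonZero n}} (α β : ℚ) → 0ℚ < α → 0ℚ < β →
    (I J : Image k n) →
    ((J′ : Image k n) → deLe J J′ β → dH J J′ ≤ α) →
    (I′ : Image k n) → deLe I I′ β → dH I I′ ≤ α + (+ 2 / 1) * dH I J
lemma19 k n α β _ _ I J J-robust I′ (s , moves , s/pairs≤β) = begin
  dH I I′                                         ≤⟨ /-monoˡ-≤ (n ℕ.* n) (+≤+ (mismatches-relabel σ I′≐σI J′≐σJ)) ⟩
  (+ mismatches J J′ ℤ.+ + (2 ℕ.* mismatches I J)) / (n ℕ.* n)
                                                  ≡⟨ /-distribʳ-+ (+ mismatches J J′) (+ (2 ℕ.* mismatches I J)) (n ℕ.* n) ⟩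
  dH J J′ + (+ (2 ℕ.* mismatches I J)) / (n ℕ.* n) ≡⟨ cong (λ q → dH J J′ + q) (/-double (mismatches I J) (n ℕ.* n)) ⟩
  dH J J′ + (+ 2 / 1) * dH I J                    ≤⟨ ℚ.+-monoˡ-≤ _ (J-robust J′ (s , moves-replay moves J′≐σJ , s/pairs≤β)) ⟩
  α + (+ 2 / 1) * dH I J                          ∎
  where
  open ℚ.≤-Reasoning
  instance _ = ℕ.m*n≢0 n n

  σ : Permutation′ (n ℕ.+ n)
  σ = moves-permutation moves

  I′≐σI : graphOf I′ ≐ relabel σ (graphOf I)
  I′≐σI = moves-relabel moves

  J′ : Image k n
  J′ = proj₁ (relabel-graphOf σ I′≐σI J)

  J′≐σJ : graphOf J′ ≐ relabel σ (graphOf J)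
  J′≐σJ = proj₂ (relabel-graphOf σ I′≐σI J)
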